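{- Let $p>3$ be a prime. Then $V_{p-1}\equiv256^{p-1}\pmod{p^3}$.
   Context: For $n\ge0$, $V_n=\sum_{k=0}^n\binom{2k}{k}^2\binom{2n-2k}{n-k}^2$. -}

module Defs where

open import Data.Nat using (ℕ; zero; suc; _+_; _*_; _∸_; _^_)
open import Data.Nat.Combinatorics using (_C_)

sumTo : ℕ → (ℕ → ℕ) → ℕ
sumTo zero    f = f 0
sumTo (suc n) f = sumTo n f + f (suc n)

V : ℕ → ℕ
V n = sumTo n (λ k → ((2 * k) C k) ^ 2 * ((2 * (n ∸ k)) C (n ∸ k)) ^ 2)

module Submission where

-- Write p = 2m + 1 and Aₖ = C(2k, k).  The sum V_{2m} is symmetric under
-- k ↦ 2m - k, so it is twice the sum over k < m plus the middle term A_m⁴.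
--  * For k < m, p divides A_{2m-k} = p·Bₖ, and (2k+1)·Aₖ·Bₖ ≡ -1 (mod p)
--    (true for k = 0 by a factorial computation, and propagated along the
--    recurrence (k+1) A_{k+1} = 2(2k+1) Aₖ).  Hence the k-th term is
--    p²(AₖBₖ)² with (AₖBₖ)² ≡ (2k+1)⁻², and Σ_{k<m} (2k+1)⁻² ≡ 0 (mod p)
--    makes these terms vanish modulo p³.
--  * A_m² ≡ 256^m (mod p³) is Morley's congruence (squared), obtained from
--    Π_{i<m} (p² - (2i+1)²) ≡ Π_{i<m} (-(2i+1)²) (mod p³), which again rests
--    on Σ_{i<m} (2i+1)⁻² ≡ 0 (mod p).

open import Data.Nat as ℕ using (ℕ; suc; _<_)
open import Data.Nat.Primality using (Prime)
open import Relation.Binary.PropositionalEquality using (_≡_)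
open import Defs

module Congruence where
  open import Data.Nat as ℕ using (ℕ)
  open import Data.Integer using (ℤ; +_; -_; _+_; _*_; _-_; 0ℤ)
  open import Data.Integer.Divisibility.Signed
  open import Data.Integer.Tactic.RingSolver using (solve-∀)
  open import Level using (0ℓ)
  open import Relation.Binary.Bundles using (Setoid)
  open import Relation.Binary.Structures using (IsEquivalence)
  open import Relation.Binary.PropositionalEquality using (_≡_; refl; sym; subst; cong; module ≡-Reasoning)
  open import Data.Integer.Properties using (pos-+; pos-*)
  import Relation.Binary.Reasoning.Setoid as SetoidReasoning

  -- Congruence of integers modulo a natural number.  It is a record so that
  -- the modulus stays visible to type inference.
  infix 4 _≡_[mod_]
  record _≡_[mod_] (a b : ℤ) (n : ℕ) : Set where
    constructor mk≡mod
    field divides-difference : + n ∣ a - b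
  open _≡_[mod_] public

  private
    along : ∀ {n x y} → x ≡ y → + n ∣ x → + n ∣ y
    along {n} = subst (+ n ∣_)

    split-difference : ∀ a b c → a - c ≡ (a - b) + (b - c)
    split-difference = solve-∀
    swap-difference : ∀ a b → b - a ≡ - (a - b)
    swap-difference = solve-∀
    sum-difference : ∀ a b c d → (a + c) - (b + d) ≡ (a - b) + (c - d)
    sum-difference = solve-∀
    product-difference : ∀ a b c d → a * c - b * d ≡ (a - b) * c + b * (c - d)
    product-difference = solve-∀
    negation-difference : ∀ a b → (- a) - (- b) ≡ - (a - b)
    negation-difference = solve-∀
    self-difference : ∀ a → 0ℤ ≡ a - a
    self-difference = solve-∀
    zero-difference : ∀ a → a ≡ a - 0ℤ
    zero-difference = solve-∀

  ≡mod-refl : ∀ {n a} → a ≡ a [mod n ]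
  ≡mod-refl {n} {a} = mk≡mod (along (self-difference a) (divides 0ℤ refl))

  ≡⇒≡mod : ∀ {n a b} → a ≡ b → a ≡ b [mod n ]
  ≡⇒≡mod refl = ≡mod-refl

  ≡mod-sym : ∀ {n a b} → a ≡ b [mod n ] → b ≡ a [mod n ]
  ≡mod-sym {a = a} {b} (mk≡mod d) = mk≡mod (along (sym (swap-difference a b)) (∣m⇒∣-m d))

  ≡mod-trans : ∀ {n a b c} → a ≡ b [mod n ] → b ≡ c [mod n ] → a ≡ c [mod n ]
  ≡mod-trans {a = a} {b} {c} (mk≡mod d) (mk≡mod e) =
    mk≡mod (along (sym (split-difference a b c)) (∣m∣n⇒∣m+n d e))

  +-cong-mod : ∀ {n a b c d} → a ≡ b [mod n ] → c ≡ d [mod n ] → a + c ≡ b + d [mod n ]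
  +-cong-mod {a = a} {b} {c} {d} (mk≡mod x) (mk≡mod y) =
    mk≡mod (along (sym (sum-difference a b c d)) (∣m∣n⇒∣m+n x y))

  *-cong-mod : ∀ {n a b c d} → a ≡ b [mod n ] → c ≡ d [mod n ] → a * c ≡ b * d [mod n ]
  *-cong-mod {a = a} {b} {c} {d} (mk≡mod x) (mk≡mod y) =
    mk≡mod (along (sym (product-difference a b c d)) (∣m∣n⇒∣m+n (∣m⇒∣m*n c x) (∣n⇒∣m*n b y)))

  -‿cong-mod : ∀ {n a b} → a ≡ b [mod n ] → - a ≡ - b [mod n ]
  -‿cong-mod {a = a} {b} (mk≡mod x) = mk≡mod (along (sym (negation-difference a b)) (∣m⇒∣-m x))

  *-congˡ-mod : ∀ {n} a {c d} → c ≡ d [mod n ] → a * c ≡ a * d [mod n ]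
  *-congˡ-mod a = *-cong-mod (≡mod-refl {a = a})

  *-congʳ-mod : ∀ {n} c {a b} → a ≡ b [mod n ] → a * c ≡ b * c [mod n ]
  *-congʳ-mod c e = *-cong-mod e (≡mod-refl {a = c})

  +-congˡ-mod : ∀ {n} a {c d} → c ≡ d [mod n ] → a + c ≡ a + d [mod n ]
  +-congˡ-mod a = +-cong-mod (≡mod-refl {a = a})

  +-congʳ-mod : ∀ {n} c {a b} → a ≡ b [mod n ] → a + c ≡ b + c [mod n ]
  +-congʳ-mod c e = +-cong-mod e (≡mod-refl {a = c})

  ∣⇒≡0-mod : ∀ {n a} → + n ∣ a → a ≡ 0ℤ [mod n ]
  ∣⇒≡0-mod {a = a} d = mk≡mod (along (zero-difference a) d)

  ≡0-mod⇒∣ : ∀ {n a} → a ≡ 0ℤ [mod n ] → + n ∣ a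
  ≡0-mod⇒∣ {a = a} (mk≡mod d) = along (sym (zero-difference a)) d

  ≡mod-isEquivalence : (n : ℕ) → IsEquivalence (_≡_[mod n ])
  ≡mod-isEquivalence n = record { refl = ≡mod-refl ; sym = ≡mod-sym ; trans = ≡mod-trans }

  ≡mod-setoid : ℕ → Setoid 0ℓ 0ℓ
  ≡mod-setoid n = record { isEquivalence = ≡mod-isEquivalence n }

  module ≡mod-Reasoning (n : ℕ) = SetoidReasoning (≡mod-setoid n)

  opposite-mod : ∀ {n} k a b → a ℕ.+ b ≡ k ℕ.* n → + a ≡ - + b [mod n ]
  opposite-mod {n} k a b a+b≡kn = mk≡mod (divides (+ k) (begin
    + a - - + b      ≡⟨ cancel-negations (+ a) (+ b) ⟩
    + a + + b        ≡⟨ pos-+ a b ⟨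
    + (a ℕ.+ b)      ≡⟨ cong +_ a+b≡kn ⟩
    + (k ℕ.* n)      ≡⟨ pos-* k n ⟩
    + k * + n        ∎))
    where open ≡-Reasoning
          cancel-negations : ∀ a b → a - - b ≡ a + b
          cancel-negations = solve-∀

  shift-mod : ∀ {n} k a b → a ≡ k ℕ.* n ℕ.+ b → + a ≡ + b [mod n ]
  shift-mod {n} k a b a≡kn+b = mk≡mod (divides (+ k) (begin
    + a - + b                ≡⟨ cong (λ t → + t - + b) a≡kn+b ⟩
    + (k ℕ.* n ℕ.+ b) - + b  ≡⟨ cong (_- + b) (pos-+ (k ℕ.* n) b) ⟩
    + (k ℕ.* n) + + b - + b  ≡⟨ cancel (+ (k ℕ.* n)) (+ b) ⟩
    + (k ℕ.* n)              ≡⟨ pos-* k n ⟩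
    + k * + n                ∎))
    where open ≡-Reasoning
          cancel : ∀ a b → a + b - b ≡ a
          cancel = solve-∀

module FiniteSums where
  open import Data.Nat as ℕ using (ℕ; zero; suc; _∸_; _<_)
  import Data.Nat.Properties as ℕP
  open import Data.Integer using (ℤ; +_; -_; _+_; _*_; 0ℤ; 1ℤ)
  open import Data.Integer.Properties
  open import Data.Integer.Tactic.RingSolver using (solve-∀)
  import Data.Nat.Tactic.RingSolver as ℕSolver
  open import Relation.Binary.PropositionalEquality
  open import Data.Product using (∃-syntax; _,_)
  open Congruence

  Σ< : ℕ → (ℕ → ℤ) → ℤ
  Σ< zero    f = 0ℤ
  Σ< (suc n) f = Σ< n f + f n

  Π< : ℕ → (ℕ → ℤ) → ℤ
  Π< zero    f = 1ℤ
  Π< (suc n) f = Π< n f * f n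

  Σ-cong : ∀ n {f g} → (∀ i → i < n → f i ≡ g i) → Σ< n f ≡ Σ< n g
  Σ-cong zero    h = refl
  Σ-cong (suc n) h = cong₂ _+_ (Σ-cong n (λ i i<n → h i (ℕP.m<n⇒m<1+n i<n))) (h n ℕP.≤-refl)

  Π-cong : ∀ n {f g} → (∀ i → i < n → f i ≡ g i) → Π< n f ≡ Π< n g
  Π-cong zero    h = refl
  Π-cong (suc n) h = cong₂ _*_ (Π-cong n (λ i i<n → h i (ℕP.m<n⇒m<1+n i<n))) (h n ℕP.≤-refl)

  Σ-cong-mod : ∀ {q} n {f g} → (∀ i → i < n → f i ≡ g i [mod q ]) → Σ< n f ≡ Σ< n g [mod q ]
  Σ-cong-mod zero    h = ≡mod-refl
  Σ-cong-mod (suc n) h =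
    +-cong-mod (Σ-cong-mod n (λ i i<n → h i (ℕP.m<n⇒m<1+n i<n))) (h n ℕP.≤-refl)

  Π-cong-mod : ∀ {q} n {f g} → (∀ i → i < n → f i ≡ g i [mod q ]) → Π< n f ≡ Π< n g [mod q ]
  Π-cong-mod zero    h = ≡mod-refl
  Π-cong-mod (suc n) h =
    *-cong-mod (Π-cong-mod n (λ i i<n → h i (ℕP.m<n⇒m<1+n i<n))) (h n ℕP.≤-refl)

  Σ-*ˡ : ∀ n c f → Σ< n (λ i → c * f i) ≡ c * Σ< n f
  Σ-*ˡ zero    c f = sym (*-zeroʳ c)
  Σ-*ˡ (suc n) c f rewrite Σ-*ˡ n c f = sym (*-distribˡ-+ c (Σ< n f) (f n))

  Σ-neg : ∀ n f → Σ< n (λ i → - f i) ≡ - Σ< n f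
  Σ-neg zero    f = refl
  Σ-neg (suc n) f rewrite Σ-neg n f = sym (neg-distrib-+ (Σ< n f) (f n))

  Π-* : ∀ n f g → Π< n (λ i → f i * g i) ≡ Π< n f * Π< n g
  Π-* zero    f g = refl
  Π-* (suc n) f g rewrite Π-* n f g = interchange (Π< n f) (Π< n g) (f n) (g n)
    where interchange : ∀ a b c d → a * b * (c * d) ≡ a * c * (b * d)
          interchange = solve-∀

  Σ-split : ∀ a b f → Σ< (a ℕ.+ b) f ≡ Σ< a f + Σ< b (λ i → f (a ℕ.+ i))
  Σ-split a zero    f rewrite ℕP.+-identityʳ a = sym (+-identityʳ (Σ< a f))
  Σ-split a (suc b) f rewrite ℕP.+-suc a b | Σ-split a b f =
    +-assoc (Σ< a f) (Σ< b (λ i → f (a ℕ.+ i))) (f (a ℕ.+ b))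

  Π-split : ∀ a b f → Π< (a ℕ.+ b) f ≡ Π< a f * Π< b (λ i → f (a ℕ.+ i))
  Π-split a zero    f rewrite ℕP.+-identityʳ a = sym (*-identityʳ (Π< a f))
  Π-split a (suc b) f rewrite ℕP.+-suc a b | Π-split a b f =
    *-assoc (Π< a f) (Π< b (λ i → f (a ℕ.+ i))) (f (a ℕ.+ b))

  Σ-reverse : ∀ n f → Σ< n f ≡ Σ< n (λ i → f (n ∸ suc i))
  Σ-reverse zero    f = refl
  Σ-reverse (suc n) f = begin
    Σ< n f + f n                             ≡⟨ cong (_+ f n) (Σ-reverse n f) ⟩
    R + f n                                  ≡⟨ +-comm R (f n) ⟩
    f n + R                                  ≡⟨ cong (_+ R) (+-identityˡ (f n)) ⟨
    0ℤ + f n + R                             ≡⟨ Σ-split 1 n (λ i → f (suc n ∸ suc i)) ⟨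
    Σ< (suc n) (λ i → f (suc n ∸ suc i))     ∎
    where open ≡-Reasoning
          R : ℤ
          R = Σ< n (λ i → f (n ∸ suc i))

  Π-reverse : ∀ n f → Π< n f ≡ Π< n (λ i → f (n ∸ suc i))
  Π-reverse zero    f = refl
  Π-reverse (suc n) f = begin
    Π< n f * f n                             ≡⟨ cong (_* f n) (Π-reverse n f) ⟩
    R * f n                                  ≡⟨ *-comm R (f n) ⟩
    f n * R                                  ≡⟨ cong (_* R) (*-identityˡ (f n)) ⟨
    1ℤ * f n * R                             ≡⟨ Π-split 1 n (λ i → f (suc n ∸ suc i)) ⟨
    Π< (suc n) (λ i → f (suc n ∸ suc i))     ∎
    where open ≡-Reasoning
          R : ℤ
          R = Π< n (λ i → f (n ∸ suc i))

  Σ-even-odd : ∀ m f → Σ< (2 ℕ.* m) f ≡ Σ< m (λ i → f (2 ℕ.* i)) + Σ< m (λ i → f (suc (2 ℕ.* i)))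
  Σ-even-odd zero    f = refl
  Σ-even-odd (suc m) f = begin
    Σ< (2 ℕ.* suc m) f                  ≡⟨ cong (λ k → Σ< k f) (ℕP.*-suc 2 m) ⟩
    Σ< (2 ℕ.* m) f + f 2m + f [2m+1]    ≡⟨ cong (λ x → x + f 2m + f [2m+1]) (Σ-even-odd m f) ⟩
    Eₘ + Oₘ + f 2m + f [2m+1]           ≡⟨ regroup Eₘ Oₘ (f 2m) (f [2m+1]) ⟩
    Eₘ + f 2m + (Oₘ + f [2m+1])         ∎
    where
      open ≡-Reasoning
      2m : ℕ
      2m = 2 ℕ.* m
      [2m+1] : ℕ
      [2m+1] = suc (2 ℕ.* m)
      Eₘ : ℤ
      Eₘ = Σ< m (λ i → f (2 ℕ.* i))
      Oₘ : ℤ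
      Oₘ = Σ< m (λ i → f (suc (2 ℕ.* i)))
      regroup : ∀ a b c d → a + b + c + d ≡ a + c + (b + d)
      regroup = solve-∀

  Σ-mirror : ∀ {q} a n f → (∀ i → i < n → f (a ℕ.+ i) ≡ f (n ∸ suc i) [mod q ]) →
             Σ< (a ℕ.+ n) f ≡ Σ< a f + Σ< n f [mod q ]
  Σ-mirror {q} a n f h = begin
    Σ< (a ℕ.+ n) f                          ≡⟨ Σ-split a n f ⟩
    Σ< a f + Σ< n (λ i → f (a ℕ.+ i))       ≈⟨ +-congˡ-mod (Σ< a f) (Σ-cong-mod n h) ⟩
    Σ< a f + Σ< n (λ i → f (n ∸ suc i))     ≡⟨ cong (_+_ (Σ< a f)) (Σ-reverse n f) ⟨
    Σ< a f + Σ< n f                         ∎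
    where open ≡mod-Reasoning q

  Πℕ : ℕ → (ℕ → ℕ) → ℕ
  Πℕ zero    f = 1
  Πℕ (suc n) f = Πℕ n f ℕ.* f n

  Πℕ-cong : ∀ n {f g} → (∀ i → f i ≡ g i) → Πℕ n f ≡ Πℕ n g
  Πℕ-cong zero    h = refl
  Πℕ-cong (suc n) h = cong₂ ℕ._*_ (Πℕ-cong n h) (h n)

  Πℕ-double : ∀ n f → Πℕ n (λ i → 2 ℕ.* f i) ≡ 2 ℕ.^ n ℕ.* Πℕ n f
  Πℕ-double zero    f = refl
  Πℕ-double (suc n) f rewrite Πℕ-double n f = regroup (2 ℕ.^ n) (Πℕ n f) (f n)
    where regroup : ∀ x y z → x ℕ.* y ℕ.* (2 ℕ.* z) ≡ 2 ℕ.* x ℕ.* (y ℕ.* z)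
          regroup = ℕSolver.solve-∀

  Πℕ-cast : ∀ n f → + (Πℕ n f) ≡ Π< n (λ i → + f i)
  Πℕ-cast zero    f = refl
  Πℕ-cast (suc n) f = trans (pos-* (Πℕ n f) (f n)) (cong (_* + f n) (Πℕ-cast n f))

  -- cofactorSum y n = Σ_{i<n} Π_{j<n, j≠i} y j, the coefficient of c in Π_{i<n} (c + y i).
  cofactorSum : (ℕ → ℤ) → ℕ → ℤ
  cofactorSum y zero    = 0ℤ
  cofactorSum y (suc n) = cofactorSum y n * y n + Π< n y

  product-expansion : ∀ c y n → ∃[ r ] Π< n (λ i → c + y i) ≡ Π< n y + c * cofactorSum y n + c * c * r
  product-expansion c y zero    = 0ℤ , vanish c
    where vanish : ∀ c → 1ℤ ≡ 1ℤ + c * 0ℤ + c * c * 0ℤ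
          vanish = solve-∀
  product-expansion c y (suc n) with product-expansion c y n
  ... | r , eq = cofactorSum y n + r * y n + c * r , (begin
    Π< n (λ i → c + y i) * (c + y n)                                   ≡⟨ cong (_* (c + y n)) eq ⟩
    (Π< n y + c * cofactorSum y n + c * c * r) * (c + y n)             ≡⟨ expand (Π< n y) (cofactorSum y n) r c (y n) ⟩
    Π< n y * y n + c * (cofactorSum y n * y n + Π< n y)
      + c * c * (cofactorSum y n + r * y n + c * r)                    ∎)
    where
      open ≡-Reasoning
      expand : ∀ P Q R c y → (P + c * Q + c * c * R) * (c + y) ≡ P * y + c * (Q * y + P) + c * c * (Q + R * y + c * R)
      expand = solve-∀

  cofactorSum-inverses : ∀ {q} y u n → (∀ i → i < n → y i * u i ≡ 1ℤ [mod q ]) →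
                         cofactorSum y n ≡ Π< n y * Σ< n u [mod q ]
  cofactorSum-inverses y u zero    h = ≡mod-refl
  cofactorSum-inverses {q} y u (suc n) h = begin
    cofactorSum y n * y n + P                ≈⟨ +-congʳ-mod P (*-congʳ-mod (y n) (cofactorSum-inverses y u n (λ i i<n → h i (ℕP.m<n⇒m<1+n i<n)))) ⟩
    P * Σ< n u * y n + P                     ≡⟨ regroup P (Σ< n u) (y n) ⟩
    P * y n * Σ< n u + P * 1ℤ                ≈⟨ +-congˡ-mod (P * y n * Σ< n u) (*-congˡ-mod P (h n ℕP.≤-refl)) ⟨
    P * y n * Σ< n u + P * (y n * u n)       ≡⟨ factor P (Σ< n u) (y n) (u n) ⟩
    P * y n * (Σ< n u + u n)                 ∎
    where
      open ≡mod-Reasoning q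
      P : ℤ
      P = Π< n y
      regroup : ∀ P s y → P * s * y + P ≡ P * y * s + P * 1ℤ
      regroup = solve-∀
      factor : ∀ P s y u → P * y * s + P * (y * u) ≡ P * y * (s + u)
      factor = solve-∀

module PrimeModulus (p : ℕ) (isPrime : Prime p) where
  open import Data.Nat as ℕ using (ℕ; zero; suc; _<_; _^_; _!; NonZero; s≤s)
  import Data.Nat.Properties as ℕP
  import Data.Nat.Divisibility as ℕD
  open import Data.Nat.Primality
    using (euclidsLemma; prime⇒irreducible; prime⇒nonZero; prime⇒nonTrivial)
  open import Data.Nat.Coprimality using (Coprime; coprime-Bézout)
  open import Data.Nat.GCD using (module Bézout)
  open import Data.Integer using (ℤ; +_; -_; _+_; _*_; _-_; ∣_∣; 1ℤ)
  open import Data.Integer.Properties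
  open import Data.Integer.Divisibility.Signed
  open import Data.Integer.Tactic.RingSolver using (solve-∀)
  open import Relation.Binary.PropositionalEquality
  open import Relation.Nullary using (¬_; yes; no)
  open import Data.Sum using (inj₁; inj₂)
  open import Data.Product using (∃-syntax; _,_; proj₁; proj₂)
  open import Data.Empty using (⊥-elim)
  open Congruence
  open FiniteSums

  instance
    p≢0 : NonZero p
    p≢0 = prime⇒nonZero isPrime

  -- x is a unit modulo p: it is invertible modulo p and modulo every power of p.
  Unit : ℤ → Set
  Unit x = ¬ (+ p ∣ x)

  unit-* : ∀ {x y} → Unit x → Unit y → Unit (x * y)
  unit-* {x} {y} ux uy p∣xy
    with euclidsLemma ∣ x ∣ ∣ y ∣ isPrime (subst (p ℕD.∣_) (abs-* x y) (∣⇒∣ᵤ p∣xy))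
  ... | inj₁ p∣x = ux (∣ᵤ⇒∣ p∣x)
  ... | inj₂ p∣y = uy (∣ᵤ⇒∣ p∣y)

  unit-1 : Unit 1ℤ
  unit-1 p∣1 = ℕ.nonTrivial⇒≢1 {{prime⇒nonTrivial isPrime}} (ℕD.∣1⇒≡1 (∣⇒∣ᵤ p∣1))

  unit-Π : ∀ n f → (∀ i → i < n → Unit (f i)) → Unit (Π< n f)
  unit-Π zero    f h = unit-1
  unit-Π (suc n) f h = unit-* (unit-Π n f (λ i i<n → h i (ℕP.m<n⇒m<1+n i<n))) (h n ℕP.≤-refl)

  unit-<p : ∀ n → 0 < n → n < p → Unit (+ n)
  unit-<p n@(suc _) 0<n n<p p∣n = ℕP.<⇒≱ n<p (ℕD.∣⇒≤ (∣⇒∣ᵤ p∣n))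

  unit-! : ∀ n → n < p → Unit (+ (n !))
  unit-! zero    n<p = unit-1
  unit-! (suc n) n<p = subst Unit (sym (pos-* (suc n) (n !)))
    (unit-* (unit-<p (suc n) (s≤s ℕ.z≤n) n<p) (unit-! n (ℕP.<-trans (ℕP.n<1+n n) n<p)))

  cancel-∣ℕ : ∀ e {a b} → ¬ (p ℕD.∣ a) → (p ^ e) ℕD.∣ a ℕ.* b → (p ^ e) ℕD.∣ b
  cancel-∣ℕ zero    {a} {b} p∤a d = ℕD.1∣ b
  cancel-∣ℕ (suc e) {a} {b} p∤a d with euclidsLemma a b isPrime (ℕD.∣-trans (ℕD.m∣m*n (p ^ e)) d)
  ... | inj₁ p∣a = ⊥-elim (p∤a p∣a)
  ... | inj₂ (ℕD.divides q refl) =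
    subst (p ℕ.* (p ^ e) ℕD.∣_) (ℕP.*-comm p q)
      (ℕD.*-monoʳ-∣ p (cancel-∣ℕ e p∤a (ℕD.*-cancelˡ-∣ p (subst (p ℕ.* (p ^ e) ℕD.∣_) (regroup a q) d))))
    where regroup : ∀ a q → a ℕ.* (q ℕ.* p) ≡ p ℕ.* (a ℕ.* q)
          regroup a q = trans (sym (ℕP.*-assoc a q p)) (ℕP.*-comm (a ℕ.* q) p)

  cancel-∣ : ∀ e {u z} → Unit u → + (p ^ e) ∣ u * z → + (p ^ e) ∣ z
  cancel-∣ e {u} {z} uu d =
    ∣ᵤ⇒∣ (cancel-∣ℕ e (λ p∣u → uu (∣ᵤ⇒∣ p∣u)) (subst ((p ^ e) ℕD.∣_) (abs-* u z) (∣⇒∣ᵤ d)))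

  cancel-mod : ∀ e {u x y} → Unit u → u * x ≡ u * y [mod p ^ e ] → x ≡ y [mod p ^ e ]
  cancel-mod e {u} {x} {y} uu (mk≡mod d) = mk≡mod (cancel-∣ e uu (subst (+ (p ^ e) ∣_) (factor u x y) d))
    where factor : ∀ u x y → u * x - u * y ≡ u * (x - y)
          factor = solve-∀

  cancel-∣₁ : ∀ {u z} → Unit u → + p ∣ u * z → + p ∣ z
  cancel-∣₁ {u} {z} uu d = subst (λ n → + n ∣ z) (ℕP.*-identityʳ p)
    (cancel-∣ 1 uu (subst (λ n → + n ∣ u * z) (sym (ℕP.*-identityʳ p)) d))

  cancel-mod₁ : ∀ {u x y} → Unit u → u * x ≡ u * y [mod p ] → x ≡ y [mod p ]
  cancel-mod₁ {u} {x} {y} uu e = subst (λ n → x ≡ y [mod n ]) (ℕP.*-identityʳ p)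
    (cancel-mod 1 uu (subst (λ n → u * x ≡ u * y [mod n ]) (sym (ℕP.*-identityʳ p)) e))

  private
    pos-linear : ∀ a b c → + (a ℕ.+ b ℕ.* c) ≡ + a + + b * + c
    pos-linear a b c = trans (pos-+ a (b ℕ.* c)) (cong (_+_ (+ a)) (pos-* b c))

    coprime : ∀ n → Unit (+ n) → Coprime p n
    coprime n un (d∣p , d∣n) with prime⇒irreducible isPrime d∣p
    ... | inj₁ d≡1 = d≡1
    ... | inj₂ refl = ⊥-elim (un (∣ᵤ⇒∣ d∣n))

  inverse : ∀ n → Unit (+ n) → ∃[ u ] + n * u ≡ 1ℤ [mod p ]
  inverse n un with coprime-Bézout (coprime n un)
  ... | Bézout.+- x y eq = - + y , mk≡mod (divides (- + x) (begin
      + n * - + y - 1ℤ          ≡⟨ rearrange (+ n) (+ y) ⟩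
      - (1ℤ + + y * + n)        ≡⟨ cong -_ (pos-linear 1 y n) ⟨
      - + (1 ℕ.+ y ℕ.* n)       ≡⟨ cong (λ t → - + t) eq ⟩
      - + (x ℕ.* p)             ≡⟨ cong -_ (pos-* x p) ⟩
      - (+ x * + p)             ≡⟨ neg-distribˡ-* (+ x) (+ p) ⟩
      - + x * + p               ∎))
    where open ≡-Reasoning
          rearrange : ∀ n y → n * - y - 1ℤ ≡ - (1ℤ + y * n)
          rearrange = solve-∀
  ... | Bézout.-+ x y eq = + y , mk≡mod (divides (+ x) (begin
      + n * + y - 1ℤ            ≡⟨ cong (_- 1ℤ) (trans (*-comm (+ n) (+ y)) (sym (pos-* y n))) ⟩
      + (y ℕ.* n) - 1ℤ          ≡⟨ cong (λ t → + t - 1ℤ) eq ⟨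
      + (1 ℕ.+ x ℕ.* p) - 1ℤ    ≡⟨ cong (_- 1ℤ) (pos-linear 1 x p) ⟩
      1ℤ + + x * + p - 1ℤ       ≡⟨ cancel-one (+ x * + p) ⟩
      + x * + p                 ∎))
    where open ≡-Reasoning
          cancel-one : ∀ a → 1ℤ + a - 1ℤ ≡ a
          cancel-one = solve-∀

  inverse-unique : ∀ {x u v} → x * u ≡ 1ℤ [mod p ] → x * v ≡ 1ℤ [mod p ] → u ≡ v [mod p ]
  inverse-unique {x} {u} {v} xu≡1 xv≡1 = begin
    u              ≡⟨ *-identityʳ u ⟨
    u * 1ℤ         ≈⟨ *-congˡ-mod u xv≡1 ⟨
    u * (x * v)    ≡⟨ reassociate u x v ⟩
    (x * u) * v    ≈⟨ *-congʳ-mod v xu≡1 ⟩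
    1ℤ * v         ≡⟨ *-identityˡ v ⟩
    v              ∎
    where open ≡mod-Reasoning p
          reassociate : ∀ u x v → u * (x * v) ≡ (x * u) * v
          reassociate = solve-∀

  -- A chosen inverse modulo p of a natural number (0 if it is not a unit).
  inv : ℕ → ℤ
  inv n with p ℕD.∣? n
  ... | yes _   = + 0
  ... | no  p∤n = proj₁ (inverse n (λ p∣n → p∤n (∣⇒∣ᵤ p∣n)))

  inv-inverse : ∀ n → Unit (+ n) → + n * inv n ≡ 1ℤ [mod p ]
  inv-inverse n un with p ℕD.∣? n
  ... | yes p∣n = ⊥-elim (un (∣ᵤ⇒∣ p∣n))
  ... | no  p∤n = proj₂ (inverse n (λ p∣n → p∤n (∣⇒∣ᵤ p∣n)))

module InverseOddSquares (p : ℕ) (isPrime : Prime p) (m : ℕ) (p≡2m+1 : p ≡ suc (2 ℕ.* m)) (3<p : 3 < p) where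
  open import Data.Nat as ℕ using (ℕ; suc; _∸_; _<_; z≤n; s≤s)
  import Data.Nat.Properties as ℕP
  open import Data.Integer using (ℤ; +_; -_; _+_; _*_; _-_; 0ℤ; 1ℤ)
  open import Data.Integer.Properties using (pos-*; *-assoc; +-comm; *-zeroʳ)
  open import Data.Integer.Tactic.RingSolver using (solve-∀)
  import Data.Nat.Tactic.RingSolver as ℕSolver
  open import Relation.Binary.PropositionalEquality
  open Congruence
  open FiniteSums

  open PrimeModulus p isPrime

  2m≡m+m : 2 ℕ.* m ≡ m ℕ.+ m
  2m≡m+m = cong (m ℕ.+_) (ℕP.+-identityʳ m)

  unit-suc : ∀ {i} → i < 2 ℕ.* m → Unit (+ suc i)
  unit-suc {i} i<2m = unit-<p (suc i) (s≤s z≤n) (subst (suc i <_) (sym p≡2m+1) (s≤s i<2m))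

  unit-2 : Unit (+ 2)
  unit-2 = unit-<p 2 (s≤s z≤n) (ℕP.<-trans (s≤s (s≤s (s≤s z≤n))) 3<p)

  unit-3 : Unit (+ 3)
  unit-3 = unit-<p 3 (s≤s z≤n) 3<p

  m+i<2m : ∀ {i} → i < m → m ℕ.+ i < 2 ℕ.* m
  m+i<2m {i} i<m = subst (m ℕ.+ i <_) (sym 2m≡m+m) (ℕP.+-monoʳ-< m i<m)

  2i<2m : ∀ {i} → i < m → 2 ℕ.* i < 2 ℕ.* m
  2i<2m = ℕP.*-monoʳ-< 2

  i<2m : ∀ {i} → i < m → i < 2 ℕ.* m
  i<2m i<m = ℕP.<-≤-trans i<m (ℕP.m≤m+n m (m ℕ.+ 0))

  sq : ℕ → ℤ
  sq n = + (n ℕ.* n)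

  invSq : ℕ → ℤ
  invSq n = inv (n ℕ.* n)

  invSq-inverse : ∀ {n} → Unit (+ n) → sq n * invSq n ≡ 1ℤ [mod p ]
  invSq-inverse {n} un = inv-inverse (n ℕ.* n) (subst Unit (sym (pos-* n n)) (unit-* un un))

  invSq-cong : ∀ {a b} → sq a ≡ sq b [mod p ] → Unit (+ a) → Unit (+ b) → invSq a ≡ invSq b [mod p ]
  invSq-cong {a} {b} sqa≡sqb ua ub =
    inverse-unique {sq a} (invSq-inverse ua) (≡mod-trans (*-congʳ-mod (invSq b) sqa≡sqb) (invSq-inverse ub))

  invSq-opposite : ∀ k a b → a ℕ.+ b ≡ k ℕ.* p → Unit (+ a) → Unit (+ b) → invSq a ≡ invSq b [mod p ]
  invSq-opposite k a b a+b≡kp = invSq-cong (begin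
    + (a ℕ.* a)       ≡⟨ pos-* a a ⟩
    + a * + a         ≈⟨ *-cong-mod a≡-b a≡-b ⟩
    - + b * - + b     ≡⟨ square-neg (+ b) ⟩
    + b * + b         ≡⟨ pos-* b b ⟨
    + (b ℕ.* b)       ∎)
    where open ≡mod-Reasoning p
          a≡-b : + a ≡ - + b [mod p ]
          a≡-b = opposite-mod k a b a+b≡kp
          square-neg : ∀ x → - x * - x ≡ x * x
          square-neg = solve-∀

  invSq-shift : ∀ k a b → a ≡ k ℕ.* p ℕ.+ b → Unit (+ a) → Unit (+ b) → invSq a ≡ invSq b [mod p ]
  invSq-shift k a b a≡kp+b = invSq-cong (begin
    + (a ℕ.* a)       ≡⟨ pos-* a a ⟩
    + a * + a         ≈⟨ *-cong-mod a≡b a≡b ⟩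
    + b * + b         ≡⟨ pos-* b b ⟨
    + (b ℕ.* b)       ∎)
    where open ≡mod-Reasoning p
          a≡b : + a ≡ + b [mod p ]
          a≡b = shift-mod k a b a≡kp+b

  invSq-double : ∀ {n} → Unit (+ n) → invSq (2 ℕ.* n) ≡ invSq 2 * invSq n [mod p ]
  invSq-double {n} un = inverse-unique {sq (2 ℕ.* n)} (invSq-inverse (subst Unit (sym (pos-* 2 n)) (unit-* unit-2 un))) (begin
    sq (2 ℕ.* n) * (invSq 2 * invSq n)              ≡⟨ cong (_* (invSq 2 * invSq n)) sq-2n ⟩
    sq 2 * sq n * (invSq 2 * invSq n)               ≡⟨ interchange (sq 2) (sq n) (invSq 2) (invSq n) ⟩
    (sq 2 * invSq 2) * (sq n * invSq n)             ≈⟨ *-cong-mod (invSq-inverse unit-2) (invSq-inverse un) ⟩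
    1ℤ * 1ℤ                                         ≡⟨⟩
    1ℤ                                              ∎)
    where
      open ≡mod-Reasoning p
      sq-2n : sq (2 ℕ.* n) ≡ sq 2 * sq n
      sq-2n = trans (cong +_ (square-double n)) (pos-* 4 (n ℕ.* n))
        where square-double : ∀ n → 2 ℕ.* n ℕ.* (2 ℕ.* n) ≡ 4 ℕ.* (n ℕ.* n)
              square-double = ℕSolver.solve-∀
      interchange : ∀ a b c d → a * b * (c * d) ≡ (a * c) * (b * d)
      interchange = solve-∀

  S H Even Odd : ℤ
  S    = Σ< (2 ℕ.* m) (λ i → invSq (suc i))
  H    = Σ< m (λ i → invSq (suc i))
  Even = Σ< m (λ i → invSq (2 ℕ.* suc i))
  Odd  = Σ< m (λ i → invSq (suc (2 ℕ.* i)))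

  S≡Odd+Even : S ≡ Odd + Even
  S≡Odd+Even = trans (Σ-even-odd m (λ i → invSq (suc i)))
    (cong (_+_ Odd) (Σ-cong m (λ i _ → cong invSq (sym (ℕP.*-suc 2 i)))))

  -- Pairing n with p - n: S ≡ 2H.
  S≡H+H : S ≡ H + H [mod p ]
  S≡H+H = begin
    S                                      ≡⟨ cong (λ k → Σ< k (λ i → invSq (suc i))) 2m≡m+m ⟩
    Σ< (m ℕ.+ m) (λ i → invSq (suc i))     ≈⟨ Σ-mirror m m (λ i → invSq (suc i)) mirror ⟩
    H + H                                  ∎
    where
      open ≡mod-Reasoning p
      mirror : ∀ i → i < m → invSq (suc (m ℕ.+ i)) ≡ invSq (suc (m ∸ suc i)) [mod p ]
      mirror i i<m = invSq-opposite 1 _ _ sum≡p (unit-suc (m+i<2m i<m)) (unit-suc (i<2m j<m))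
        where
          j : ℕ
          j = m ∸ suc i
          j+i+1≡m : j ℕ.+ suc i ≡ m
          j+i+1≡m = ℕP.m∸n+n≡m i<m
          j<m : j < m
          j<m = subst (j <_) j+i+1≡m (ℕP.m<m+n j (s≤s z≤n))
          expand : ∀ m i j → suc (m ℕ.+ i) ℕ.+ suc j ≡ 1 ℕ.* suc (m ℕ.+ (j ℕ.+ suc i))
          expand = ℕSolver.solve-∀
          sum≡p : suc (m ℕ.+ i) ℕ.+ suc j ≡ 1 ℕ.* p
          sum≡p = trans (expand m i j)
            (cong (1 ℕ.*_) (trans (cong (λ t → suc (m ℕ.+ t)) j+i+1≡m) (trans (cong suc (sym 2m≡m+m)) (sym p≡2m+1))))

  -- Doubling permutes the residues: 2 ↦ 4, …, 2m ↦ 4m, and 2(m+1+i) ≡ 2i+1.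
  invSq2*S≡Even+Odd : invSq 2 * S ≡ Even + Odd [mod p ]
  invSq2*S≡Even+Odd = begin
    invSq 2 * S                                            ≡⟨ Σ-*ˡ (2 ℕ.* m) (invSq 2) (λ i → invSq (suc i)) ⟨
    Σ< (2 ℕ.* m) (λ i → invSq 2 * invSq (suc i))           ≈⟨ Σ-cong-mod (2 ℕ.* m) (λ i i<2m → ≡mod-sym (invSq-double (unit-suc i<2m))) ⟩
    Σ< (2 ℕ.* m) (λ i → invSq (2 ℕ.* suc i))               ≡⟨ cong (λ k → Σ< k (λ i → invSq (2 ℕ.* suc i))) 2m≡m+m ⟩
    Σ< (m ℕ.+ m) (λ i → invSq (2 ℕ.* suc i))               ≡⟨ Σ-split m m (λ i → invSq (2 ℕ.* suc i)) ⟩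
    Even + Σ< m (λ i → invSq (2 ℕ.* suc (m ℕ.+ i)))        ≈⟨ +-congˡ-mod Even (Σ-cong-mod m wrap) ⟩
    Even + Odd                                             ∎
    where
      open ≡mod-Reasoning p
      wrap : ∀ i → i < m → invSq (2 ℕ.* suc (m ℕ.+ i)) ≡ invSq (suc (2 ℕ.* i)) [mod p ]
      wrap i i<m = invSq-shift 1 _ _ (trans (expand m i) (cong (λ t → 1 ℕ.* t ℕ.+ suc (2 ℕ.* i)) (sym p≡2m+1)))
        (subst Unit (sym (pos-* 2 (suc (m ℕ.+ i)))) (unit-* unit-2 (unit-suc (m+i<2m i<m))))
        (unit-suc (2i<2m i<m))
        where expand : ∀ m i → 2 ℕ.* suc (m ℕ.+ i) ≡ 1 ℕ.* suc (2 ℕ.* m) ℕ.+ suc (2 ℕ.* i)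
              expand = ℕSolver.solve-∀

  -- Hence S is fixed by multiplication with 2⁻², so 3S ≡ (2² - 1)S ≡ 0.
  S≡0 : S ≡ 0ℤ [mod p ]
  S≡0 = cancel-mod₁ unit-3 (begin
    + 3 * S                        ≡⟨ three S ⟩
    sq 2 * S - S                   ≈⟨ +-congʳ-mod (- S) (*-congˡ-mod (sq 2) fixed) ⟨
    sq 2 * (invSq 2 * S) - S       ≡⟨ cong (_- S) (*-assoc (sq 2) (invSq 2) S) ⟨
    sq 2 * invSq 2 * S - S         ≈⟨ +-congʳ-mod (- S) (*-congʳ-mod S (invSq-inverse unit-2)) ⟩
    1ℤ * S - S                     ≡⟨ vanish S ⟩
    + 3 * 0ℤ                       ∎)
    where
      open ≡mod-Reasoning p
      fixed : invSq 2 * S ≡ S [mod p ]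
      fixed = ≡mod-trans invSq2*S≡Even+Odd (≡⇒≡mod (trans (+-comm Even Odd) (sym S≡Odd+Even)))
      three : ∀ s → + 3 * s ≡ + 4 * s - s
      three = solve-∀
      vanish : ∀ s → 1ℤ * s - s ≡ + 3 * 0ℤ
      vanish = solve-∀

  H≡0 : H ≡ 0ℤ [mod p ]
  H≡0 = cancel-mod₁ unit-2 (begin
    + 2 * H      ≡⟨ double H ⟩
    H + H        ≈⟨ S≡H+H ⟨
    S            ≈⟨ S≡0 ⟩
    0ℤ           ≡⟨ *-zeroʳ (+ 2) ⟨
    + 2 * 0ℤ     ∎)
    where open ≡mod-Reasoning p
          double : ∀ h → + 2 * h ≡ h + h
          double = solve-∀

  Even≡0 : Even ≡ 0ℤ [mod p ]
  Even≡0 = begin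
    Even                                   ≈⟨ Σ-cong-mod m (λ i i<m → invSq-double (unit-suc (i<2m i<m))) ⟩
    Σ< m (λ i → invSq 2 * invSq (suc i))   ≡⟨ Σ-*ˡ m (invSq 2) (λ i → invSq (suc i)) ⟩
    invSq 2 * H                            ≈⟨ *-congˡ-mod (invSq 2) H≡0 ⟩
    invSq 2 * 0ℤ                           ≡⟨ *-zeroʳ (invSq 2) ⟩
    0ℤ                                     ∎
    where open ≡mod-Reasoning p

  Odd≡0 : Odd ≡ 0ℤ [mod p ]
  Odd≡0 = begin
    Odd                  ≡⟨ subtract Odd Even ⟩
    (Odd + Even) - Even  ≡⟨ cong (_- Even) S≡Odd+Even ⟨
    S - Even             ≈⟨ +-cong-mod S≡0 (-‿cong-mod Even≡0) ⟩
    0ℤ - 0ℤ              ≡⟨⟩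
    0ℤ                   ∎
    where open ≡mod-Reasoning p
          subtract : ∀ a b → a ≡ (a + b) - b
          subtract = solve-∀

  odd : ℕ → ℤ
  odd i = + suc (2 ℕ.* i)

  Σ-inverse-odd-squares : ∀ (u : ℕ → ℤ) → (∀ i → i < m → odd i * odd i * u i ≡ 1ℤ [mod p ]) →
                          Σ< m u ≡ 0ℤ [mod p ]
  Σ-inverse-odd-squares u u-inverse = ≡mod-trans (Σ-cong-mod m same-inverse) Odd≡0
    where
      same-inverse : ∀ i → i < m → u i ≡ invSq (suc (2 ℕ.* i)) [mod p ]
      same-inverse i i<m = inverse-unique {sq (suc (2 ℕ.* i))}
        (subst (λ x → x * u i ≡ 1ℤ [mod p ]) (sym (pos-* (suc (2 ℕ.* i)) (suc (2 ℕ.* i)))) (u-inverse i i<m))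
        (invSq-inverse (unit-suc (2i<2m i<m)))

module CentralBinomial where
  open import Data.Nat
  open import Data.Nat.Properties
  open import Data.Nat.Combinatorics using (_C_; k![n∸k]!∣n!)
  open import Data.Nat.Combinatorics.Specification using (nCk≡n!/k![n-k]!)
  open import Data.Nat.DivMod using (_/_; m/n*n≡m)
  import Data.Nat.Tactic.RingSolver as ℕSolver
  open import Relation.Binary.PropositionalEquality
  open FiniteSums using (Πℕ; Πℕ-cong; Πℕ-double)

  binomial-factorial : ∀ {n k} → k ≤ n → (n C k) * (k ! * (n ∸ k) !) ≡ n !
  binomial-factorial {n} {k} k≤n = begin
    (n C k) * (k ! * (n ∸ k) !)                                         ≡⟨ cong (_* (k ! * (n ∸ k) !)) (nCk≡n!/k![n-k]! k≤n) ⟩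
    (n ! / (k ! * (n ∸ k) !)) {{k![n∸k]!≢0}} * (k ! * (n ∸ k) !)      ≡⟨ m/n*n≡m {{k![n∸k]!≢0}} (k![n∸k]!∣n! k≤n) ⟩
    n !                                                               ∎
    where open ≡-Reasoning
          k![n∸k]!≢0 : NonZero (k ! * (n ∸ k) !)
          k![n∸k]!≢0 = k !* (n ∸ k) !≢0

  central : ℕ → ℕ
  central k = (2 * k) C k

  central-factorial : ∀ k → central k * (k ! * k !) ≡ (2 * k) !
  central-factorial k = subst (λ j → central k * (k ! * j !) ≡ (2 * k) !) 2k∸k≡k
    (binomial-factorial (m≤m+n k (k + 0)))
    where 2k∸k≡k : 2 * k ∸ k ≡ k
          2k∸k≡k = trans (m+n∸m≡n k (k + 0)) (+-identityʳ k)

  private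
    positive-* : ∀ {a b} → 0 < a → 0 < b → 0 < a * b
    positive-* {a} {b} = *-mono-< {0} {a} {0} {b}

  central-step : ∀ k → central (suc k) * suc k ≡ 2 * suc (2 * k) * central k
  central-step k = *-cancelʳ-≡ _ _ (suc k * (k ! * k !)) {{>-nonZero (positive-* {suc k} z<s (positive-* (1≤n! k) (1≤n! k)))}} (begin
    central (suc k) * suc k * (suc k * (k ! * k !))                   ≡⟨ regroup (central (suc k)) (suc k) (k !) ⟩
    central (suc k) * (suc k ! * suc k !)                             ≡⟨ central-factorial (suc k) ⟩
    (2 * suc k) !                                                     ≡⟨ cong _! (*-suc 2 k) ⟩
    suc (suc (2 * k)) * (suc (2 * k) * (2 * k) !)                     ≡⟨ cong (λ t → suc (suc (2 * k)) * (suc (2 * k) * t)) (central-factorial k) ⟨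
    suc (suc (2 * k)) * (suc (2 * k) * (central k * (k ! * k !)))     ≡⟨ factor k (central k) (k !) ⟩
    2 * suc (2 * k) * central k * (suc k * (k ! * k !))               ∎)
    where
      open ≡-Reasoning
      regroup : ∀ c s f → c * s * (s * (f * f)) ≡ c * ((s * f) * (s * f))
      regroup = ℕSolver.solve-∀
      factor : ∀ k c f → suc (suc (2 * k)) * (suc (2 * k) * (c * (f * f))) ≡ 2 * suc (2 * k) * c * (suc k * (f * f))
      factor = ℕSolver.solve-∀

  rising-factorial : ∀ n k → Πℕ k (λ i → suc (n + i)) * n ! ≡ (n + k) !
  rising-factorial n zero    = trans (*-identityˡ (n !)) (cong _! (sym (+-identityʳ n)))
  rising-factorial n (suc k) = begin
    Πℕ k (λ i → suc (n + i)) * suc (n + k) * n !     ≡⟨ regroup (Πℕ k (λ i → suc (n + i))) (suc (n + k)) (n !) ⟩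
    suc (n + k) * (Πℕ k (λ i → suc (n + i)) * n !)   ≡⟨ cong (suc (n + k) *_) (rising-factorial n k) ⟩
    suc (n + k) !                                    ≡⟨ cong _! (+-suc n k) ⟨
    (n + suc k) !                                    ∎
    where open ≡-Reasoning
          regroup : ∀ a b c → a * b * c ≡ b * (a * c)
          regroup = ℕSolver.solve-∀

  evens odds : ℕ → ℕ
  evens m = Πℕ m (λ i → 2 * suc i)
  odds  m = Πℕ m (λ i → suc (2 * i))

  evens≡2^m*m! : ∀ m → evens m ≡ 2 ^ m * m !
  evens≡2^m*m! zero    = refl
  evens≡2^m*m! (suc m) rewrite evens≡2^m*m! m = regroup (2 ^ m) (m !) (suc m)
    where regroup : ∀ x f s → x * f * (2 * s) ≡ 2 * x * (s * f)
          regroup = ℕSolver.solve-∀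

  factorial-evens-odds : ∀ m → (2 * m) ! ≡ evens m * odds m
  factorial-evens-odds zero    = refl
  factorial-evens-odds (suc m) = begin
    (2 * suc m) !                                               ≡⟨ cong _! (*-suc 2 m) ⟩
    suc (suc (2 * m)) * (suc (2 * m) * (2 * m) !)               ≡⟨ cong (λ t → suc (suc (2 * m)) * (suc (2 * m) * t)) (factorial-evens-odds m) ⟩
    suc (suc (2 * m)) * (suc (2 * m) * (evens m * odds m))      ≡⟨ regroup m (evens m) (odds m) ⟩
    evens m * (2 * suc m) * (odds m * suc (2 * m))              ∎
    where open ≡-Reasoning
          regroup : ∀ m e o → suc (suc (2 * m)) * (suc (2 * m) * (e * o)) ≡ e * (2 * suc m) * (o * suc (2 * m))
          regroup = ℕSolver.solve-∀

  4^m≡2^m*2^m : ∀ m → 4 ^ m ≡ 2 ^ m * 2 ^ m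
  4^m≡2^m*2^m zero    = refl
  4^m≡2^m*2^m (suc m) rewrite 4^m≡2^m*2^m m = regroup (2 ^ m)
    where regroup : ∀ x → 4 * (x * x) ≡ 2 * x * (2 * x)
          regroup = ℕSolver.solve-∀

  central-evens : ∀ m → central m * evens m ≡ 4 ^ m * odds m
  central-evens m = *-cancelʳ-≡ _ _ (evens m) {{>-nonZero (evens-positive m)}} (begin
    central m * evens m * evens m                   ≡⟨ cong (λ t → central m * t * t) (evens≡2^m*m! m) ⟩
    central m * (2 ^ m * m !) * (2 ^ m * m !)       ≡⟨ regroup (central m) (2 ^ m) (m !) ⟩
    2 ^ m * 2 ^ m * (central m * (m ! * m !))       ≡⟨ cong₂ _*_ (sym (4^m≡2^m*2^m m)) (central-factorial m) ⟩
    4 ^ m * (2 * m) !                               ≡⟨ cong (4 ^ m *_) (factorial-evens-odds m) ⟩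
    4 ^ m * (evens m * odds m)                      ≡⟨ rearrange (4 ^ m) (evens m) (odds m) ⟩
    4 ^ m * odds m * evens m                        ∎)
    where
      open ≡-Reasoning
      evens-positive : ∀ m → 0 < evens m
      evens-positive zero    = z<s
      evens-positive (suc m) = positive-* (evens-positive m) z<s
      regroup : ∀ c x f → c * (x * f) * (x * f) ≡ x * x * (c * (f * f))
      regroup = ℕSolver.solve-∀
      rearrange : ∀ a e o → a * (e * o) ≡ a * o * e
      rearrange = ℕSolver.solve-∀

  -- (2m+2)(2m+4)⋯(4m) = 4^m · 1·3⋯(2m - 1): the odd numbers shifted by p = 2m + 1.
  shifted-odds : ∀ m → Πℕ m (λ i → suc (2 * m) + suc (2 * i)) ≡ 4 ^ m * odds m
  shifted-odds m = *-cancelʳ-≡ _ _ (m !) {{>-nonZero (1≤n! m)}} (begin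
    Πℕ m (λ i → suc (2 * m) + suc (2 * i)) * m !     ≡⟨ cong (_* m !) (Πℕ-cong m (double-sum m)) ⟩
    Πℕ m (λ i → 2 * suc (m + i)) * m !               ≡⟨ cong (_* m !) (Πℕ-double m (λ i → suc (m + i))) ⟩
    2 ^ m * Πℕ m (λ i → suc (m + i)) * m !           ≡⟨ *-assoc (2 ^ m) (Πℕ m (λ i → suc (m + i))) (m !) ⟩
    2 ^ m * (Πℕ m (λ i → suc (m + i)) * m !)         ≡⟨ cong (2 ^ m *_) (rising-factorial m m) ⟩
    2 ^ m * (m + m) !                                ≡⟨ cong (λ t → 2 ^ m * (m + t) !) (+-identityʳ m) ⟨
    2 ^ m * (2 * m) !                                ≡⟨ cong (2 ^ m *_) (factorial-evens-odds m) ⟩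
    2 ^ m * (evens m * odds m)                       ≡⟨ cong (λ t → 2 ^ m * (t * odds m)) (evens≡2^m*m! m) ⟩
    2 ^ m * (2 ^ m * m ! * odds m)                   ≡⟨ regroup (2 ^ m) (m !) (odds m) ⟩
    2 ^ m * 2 ^ m * odds m * m !                     ≡⟨ cong (λ t → t * odds m * m !) (4^m≡2^m*2^m m) ⟨
    4 ^ m * odds m * m !                             ∎)
    where
      open ≡-Reasoning
      double-sum : ∀ m i → suc (2 * m) + suc (2 * i) ≡ 2 * suc (m + i)
      double-sum = ℕSolver.solve-∀
      regroup : ∀ x f o → x * (x * f * o) ≡ x * x * o * f
      regroup = ℕSolver.solve-∀

module Morley (p : ℕ) (isPrime : Prime p) (m : ℕ) (p≡2m+1 : p ≡ suc (2 ℕ.* m)) (3<p : 3 < p) where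
  open import Data.Nat as ℕ using (ℕ; zero; suc; _∸_; _<_; _^_)
  import Data.Nat.Properties as ℕP
  open import Data.Integer using (ℤ; +_; -_; _+_; _*_; _-_; 0ℤ; 1ℤ)
  open import Data.Integer.Properties using (pos-*; pos-+; *-zeroʳ)
  open import Data.Integer.Divisibility.Signed using (_∣_; *-monoʳ-∣; ∣m⇒∣m*n; ∣m∣n⇒∣m+n; ∣-refl)
  open import Data.Integer.Tactic.RingSolver using (solve-∀)
  import Data.Nat.Tactic.RingSolver as ℕSolver
  open import Data.Product using (_,_)
  open import Relation.Binary.PropositionalEquality
  open Congruence
  open FiniteSums
  open CentralBinomial

  open PrimeModulus p isPrime
  open InverseOddSquares p isPrime m p≡2m+1 3<p

  y : ℕ → ℤ
  y i = - (odd i * odd i)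

  P : ℤ
  P = Π< m y

  p^3≡p*p*p : + (p ^ 3) ≡ + p * + p * + p
  p^3≡p*p*p = trans (cong +_ (cube p)) (trans (pos-* (p ℕ.* p) p) (cong (_* + p) (pos-* p p)))
    where cube : ∀ p → p ℕ.* (p ℕ.* (p ℕ.* 1)) ≡ p ℕ.* p ℕ.* p
          cube = ℕSolver.solve-∀

  -- Since Σ (2i+1)⁻² ≡ 0 (mod p), perturbing every factor of P by p² changes P
  -- only modulo p³:  Π_{i<m} (p² - (2i+1)²) ≡ P (mod p³).
  perturbed-product : Π< m (λ i → + p * + p + y i) ≡ P [mod p ^ 3 ]
  perturbed-product with product-expansion (+ p * + p) y m
  ... | r , expansion = mk≡mod (subst (_∣ (Π< m (λ i → + p * + p + y i) - P)) (sym p^3≡p*p*p)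
        (subst (+ p * + p * + p ∣_) (sym difference) (∣m∣n⇒∣m+n linear-term quadratic-term)))
    where
      c : ℤ
      c = + p * + p
      Q : ℤ
      Q = cofactorSum y m
      difference : Π< m (λ i → c + y i) - P ≡ c * Q + c * c * r
      difference = trans (cong (_- P) expansion) (cancel P (c * Q) (c * c * r))
        where cancel : ∀ a b d → a + b + d - a ≡ b + d
              cancel = solve-∀
      u : ℕ → ℤ
      u i = - invSq (suc (2 ℕ.* i))
      y*u≡1 : ∀ i → i < m → y i * u i ≡ 1ℤ [mod p ]
      y*u≡1 i i<m = ≡mod-trans (≡⇒≡mod (trans (neg*neg (odd i) (invSq (suc (2 ℕ.* i))))
                                       (cong (_* invSq (suc (2 ℕ.* i))) (sym (pos-* (suc (2 ℕ.* i)) (suc (2 ℕ.* i)))))))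
                               (invSq-inverse (unit-suc (2i<2m i<m)))
        where neg*neg : ∀ a w → - (a * a) * - w ≡ a * a * w
              neg*neg = solve-∀
      Σu≡0 : Σ< m u ≡ 0ℤ [mod p ]
      Σu≡0 = ≡mod-trans (≡⇒≡mod (Σ-neg m (λ i → invSq (suc (2 ℕ.* i))))) (-‿cong-mod Odd≡0)
      p∣Q : + p ∣ Q
      p∣Q = ≡0-mod⇒∣ (≡mod-trans (cofactorSum-inverses y u m y*u≡1)
                      (≡mod-trans (*-congˡ-mod P Σu≡0) (≡⇒≡mod (*-zeroʳ P))))
      linear-term : + p * + p * + p ∣ c * Q
      linear-term = *-monoʳ-∣ c p∣Q
      quadratic-term : + p * + p * + p ∣ c * c * r
      quadratic-term = subst (+ p * + p * + p ∣_) (regroup (+ p) r) (∣m⇒∣m*n (+ p * r) ∣-refl)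
        where regroup : ∀ p r → p * p * p * (p * r) ≡ p * p * (p * p) * r
              regroup = solve-∀

  O E T C : ℤ
  O = + odds m
  E = + evens m
  T = + (4 ^ m)
  C = + central m

  Π[p+odd]≡T*O : Π< m (λ i → + p + odd i) ≡ T * O
  Π[p+odd]≡T*O = begin
    Π< m (λ i → + p + odd i)                               ≡⟨ Π-cong m (λ i _ → p+odd i) ⟩
    Π< m (λ i → + (suc (2 ℕ.* m) ℕ.+ suc (2 ℕ.* i)))        ≡⟨ Πℕ-cast m (λ i → suc (2 ℕ.* m) ℕ.+ suc (2 ℕ.* i)) ⟨
    + Πℕ m (λ i → suc (2 ℕ.* m) ℕ.+ suc (2 ℕ.* i))          ≡⟨ cong +_ (shifted-odds m) ⟩
    + (4 ^ m ℕ.* odds m)                                    ≡⟨ pos-* (4 ^ m) (odds m) ⟩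
    T * O                                                   ∎
    where open ≡-Reasoning
          p+odd : ∀ i → + p + odd i ≡ + (suc (2 ℕ.* m) ℕ.+ suc (2 ℕ.* i))
          p+odd i = trans (cong (λ q → + q + odd i) p≡2m+1) (sym (pos-+ (suc (2 ℕ.* m)) (suc (2 ℕ.* i))))

  Π[p-odd]≡E : Π< m (λ i → + p - odd i) ≡ E
  Π[p-odd]≡E = sym (begin
    + evens m                                        ≡⟨ Πℕ-cast m (λ i → 2 ℕ.* suc i) ⟩
    Π< m (λ i → + (2 ℕ.* suc i))                     ≡⟨ Π-reverse m (λ i → + (2 ℕ.* suc i)) ⟩
    Π< m (λ i → + (2 ℕ.* suc (m ∸ suc i)))           ≡⟨ Π-cong m reflect ⟩
    Π< m (λ i → + p - odd i)                         ∎)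
    where
      open ≡-Reasoning
      reflect : ∀ i → i < m → + (2 ℕ.* suc (m ∸ suc i)) ≡ + p - odd i
      reflect i i<m = begin
        + a                            ≡⟨ add-subtract (+ a) (odd i) ⟩
        + a + odd i - odd i            ≡⟨ cong (_- odd i) (pos-+ a (suc (2 ℕ.* i))) ⟨
        + (a ℕ.+ suc (2 ℕ.* i)) - odd i ≡⟨ cong (λ t → + t - odd i) a+2i+1≡p ⟩
        + p - odd i                    ∎
        where
          j : ℕ
          j = m ∸ suc i
          a : ℕ
          a = 2 ℕ.* suc j
          add-subtract : ∀ a b → a ≡ a + b - b
          add-subtract = solve-∀
          expand : ∀ j i → 2 ℕ.* suc j ℕ.+ suc (2 ℕ.* i) ≡ suc (2 ℕ.* (j ℕ.+ suc i))
          expand = ℕSolver.solve-∀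
          a+2i+1≡p : a ℕ.+ suc (2 ℕ.* i) ≡ p
          a+2i+1≡p = trans (expand j i) (trans (cong (λ t → suc (2 ℕ.* t)) (ℕP.m∸n+n≡m i<m)) (sym p≡2m+1))

  T*O*E≡P : T * O * E ≡ P [mod p ^ 3 ]
  T*O*E≡P = ≡mod-trans (≡⇒≡mod (begin
    T * O * E                                              ≡⟨ cong₂ _*_ Π[p+odd]≡T*O Π[p-odd]≡E ⟨
    Π< m (λ i → + p + odd i) * Π< m (λ i → + p - odd i)    ≡⟨ Π-* m (λ i → + p + odd i) (λ i → + p - odd i) ⟨
    Π< m (λ i → (+ p + odd i) * (+ p - odd i))             ≡⟨ Π-cong m (λ i _ → difference-of-squares (+ p) (odd i)) ⟩
    Π< m (λ i → + p * + p + y i)                           ∎)) perturbed-product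
    where open ≡-Reasoning
          difference-of-squares : ∀ a b → (a + b) * (a - b) ≡ a * a + - (b * b)
          difference-of-squares = solve-∀

  P*P≡O⁴ : P * P ≡ O * O * (O * O)
  P*P≡O⁴ = begin
    P * P                                           ≡⟨ Π-* m y y ⟨
    Π< m (λ i → y i * y i)                          ≡⟨ Π-cong m (λ i _ → square-neg (odd i)) ⟩
    Π< m (λ i → odd i * odd i * (odd i * odd i))    ≡⟨ Π-* m (λ i → odd i * odd i) (λ i → odd i * odd i) ⟩
    Π< m (λ i → odd i * odd i) * Π< m (λ i → odd i * odd i)
                                                    ≡⟨ cong₂ _*_ (Π-* m odd odd) (Π-* m odd odd) ⟩
    Π< m odd * Π< m odd * (Π< m odd * Π< m odd)     ≡⟨ cong (λ t → t * t * (t * t)) (Πℕ-cast m (λ i → suc (2 ℕ.* i))) ⟨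
    O * O * (O * O)                                 ∎
    where open ≡-Reasoning
          square-neg : ∀ o → - (o * o) * - (o * o) ≡ o * o * (o * o)
          square-neg = solve-∀

  unit-O : Unit O
  unit-O = subst Unit (sym (Πℕ-cast m (λ i → suc (2 ℕ.* i))))
    (unit-Π m (λ i → odd i) (λ i i<m → unit-suc (2i<2m i<m)))

  unit-E : Unit E
  unit-E = subst Unit (sym (Πℕ-cast m (λ i → 2 ℕ.* suc i)))
    (unit-Π m (λ i → + (2 ℕ.* suc i)) (λ i i<m → subst Unit (sym (pos-* 2 (suc i))) (unit-* unit-2 (unit-suc (i<2m i<m)))))

  256^m≡[4^m]⁴ : ∀ n → 256 ^ n ≡ 4 ^ n ℕ.* 4 ^ n ℕ.* (4 ^ n ℕ.* 4 ^ n)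
  256^m≡[4^m]⁴ zero    = refl
  256^m≡[4^m]⁴ (suc n) = trans (cong (256 ℕ.*_) (256^m≡[4^m]⁴ n)) (regroup (4 ^ n))
    where regroup : ∀ x → 256 ℕ.* (x ℕ.* x ℕ.* (x ℕ.* x)) ≡ 4 ℕ.* x ℕ.* (4 ℕ.* x) ℕ.* (4 ℕ.* x ℕ.* (4 ℕ.* x))
          regroup = ℕSolver.solve-∀

  -- Morley's congruence, squared: with Z = E·O a unit,
  -- Z²C² = (CE)²O² = T²O⁴ = T²P² ≡ T²(TOE)² = Z²T⁴ (mod p³).
  morley² : C * C ≡ + (256 ^ m) [mod p ^ 3 ]
  morley² = ≡mod-trans (cancel-mod 3 (unit-* unit-Z unit-Z) (begin
    Z * Z * (C * C)                     ≡⟨ regroup₁ C E O ⟩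
    (C * E) * (C * E) * (O * O)         ≡⟨ cong (λ t → t * t * (O * O)) C*E≡T*O ⟩
    (T * O) * (T * O) * (O * O)         ≡⟨ regroup₂ T O ⟩
    T * T * (O * O * (O * O))           ≡⟨ cong (T * T *_) P*P≡O⁴ ⟨
    T * T * (P * P)                     ≈⟨ *-congˡ-mod (T * T) (*-cong-mod T*O*E≡P T*O*E≡P) ⟨
    T * T * ((T * O * E) * (T * O * E)) ≡⟨ regroup₃ T O E ⟩
    Z * Z * (T * T * (T * T))           ∎)) (≡⇒≡mod (sym T⁴≡256^m))
    where
      open ≡mod-Reasoning (p ^ 3)
      Z : ℤ
      Z = E * O
      unit-Z : Unit Z
      unit-Z = unit-* unit-E unit-O
      C*E≡T*O : C * E ≡ T * O
      C*E≡T*O = trans (sym (pos-* (central m) (evens m))) (trans (cong +_ (central-evens m)) (pos-* (4 ^ m) (odds m)))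
      T⁴≡256^m : + (256 ^ m) ≡ T * T * (T * T)
      T⁴≡256^m = trans (cong +_ (256^m≡[4^m]⁴ m))
        (trans (pos-* (4 ^ m ℕ.* 4 ^ m) (4 ^ m ℕ.* 4 ^ m)) (cong₂ _*_ (pos-* (4 ^ m) (4 ^ m)) (pos-* (4 ^ m) (4 ^ m))))
      regroup₁ : ∀ c e o → e * o * (e * o) * (c * c) ≡ (c * e) * (c * e) * (o * o)
      regroup₁ = solve-∀
      regroup₂ : ∀ t o → (t * o) * (t * o) * (o * o) ≡ t * t * (o * o * (o * o))
      regroup₂ = solve-∀
      regroup₃ : ∀ t o e → t * t * ((t * o * e) * (t * o * e)) ≡ e * o * (e * o) * (t * t * (t * t))
      regroup₃ = solve-∀

module CentralQuotients (p : ℕ) (isPrime : Prime p) (m : ℕ) (p≡2m+1 : p ≡ suc (2 ℕ.* m)) (3<p : 3 < p) where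
  open import Data.Nat as ℕ using (ℕ; zero; suc; _∸_; _<_; _≤_; _!; z≤n; s≤s)
  import Data.Nat.Properties as ℕP
  import Data.Nat.Divisibility as ℕD
  open import Data.Nat.DivMod using (_/_; m*[n/m]≡n)
  open import Data.Integer using (ℤ; +_; -_; _+_; _*_; _-_; 1ℤ)
  open import Data.Integer.Properties using (pos-*; *-identityˡ; *-identityʳ)
  open import Data.Integer.Divisibility.Signed using (_∣_; ∣ᵤ⇒∣; ∣⇒∣ᵤ)
  open import Data.Integer.Tactic.RingSolver using (solve-∀)
  import Data.Nat.Tactic.RingSolver as ℕSolver
  open import Relation.Binary.PropositionalEquality
  open Congruence
  open FiniteSums
  open CentralBinomial

  open PrimeModulus p isPrime
  open InverseOddSquares p isPrime m p≡2m+1 3<p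

  -- p divides C(2j, j) whenever j < p ≤ 2j: it divides (2j)! = C(2j, j) · j!²
  -- but not j!.
  p∣central : ∀ j → p ≤ 2 ℕ.* j → j < p → p ℕD.∣ central j
  p∣central j p≤2j j<p = ∣⇒∣ᵤ (cancel-∣₁ unit-j!² (subst (+ p ∣_) [2j]!≡j!²*central (∣ᵤ⇒∣ p∣[2j]!)))
    where
      unit-j!² : Unit (+ (j ! ℕ.* j !))
      unit-j!² = subst Unit (sym (pos-* (j !) (j !))) (unit-* (unit-! j j<p) (unit-! j j<p))
      p∣p! : p ℕD.∣ p !
      p∣p! rewrite p≡2m+1 = ℕD.m∣m*n ((2 ℕ.* m) !)
      p∣[2j]! : p ℕD.∣ (2 ℕ.* j) !
      p∣[2j]! = ℕD.∣-trans p∣p! (ℕD.m≤n⇒m!∣n! p≤2j)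
      [2j]!≡j!²*central : + ((2 ℕ.* j) !) ≡ + (j ! ℕ.* j !) * + central j
      [2j]!≡j!²*central = trans (cong +_ (trans (sym (central-factorial j)) (ℕP.*-comm (central j) (j ! ℕ.* j !))))
                                (pos-* (j ! ℕ.* j !) (central j))

  complement : ℕ → ℕ
  complement k = 2 ℕ.* m ∸ k

  B : ℕ → ℕ
  B k = central (complement k) / p

  complement+k : ∀ {k} → k ≤ 2 ℕ.* m → complement k ℕ.+ k ≡ 2 ℕ.* m
  complement+k = ℕP.m∸n+n≡m

  -- For k < m the complementary index lies strictly between m and p, so p divides
  -- its central binomial coefficient.
  central-complement : ∀ {k} → k < m → central (complement k) ≡ p ℕ.* B k
  central-complement {k} k<m = sym (m*[n/m]≡n (p∣central j p≤2j j<p))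
    where
      j : ℕ
      j = complement k
      m<j : m < j
      m<j = ℕP.+-cancelʳ-< k m j (subst (m ℕ.+ k <_) (sym (complement+k (ℕP.<⇒≤ (i<2m k<m)))) (m+i<2m k<m))
      p≤2j : p ≤ 2 ℕ.* j
      p≤2j = subst (_≤ 2 ℕ.* j) (sym p≡2m+1) (ℕP.*-monoʳ-< 2 m<j)
      j<p : j < p
      j<p = subst (j <_) (sym p≡2m+1) (s≤s (ℕP.m∸n≤m (2 ℕ.* m) k))

  -- m > 0 because p > 3, so 2m = t + 1 with t = 2m - 1 < p.
  0<m : 0 < m
  0<m = positive m (subst (3 <_) p≡2m+1 3<p)
    where positive : ∀ n → 3 < suc (2 ℕ.* n) → 0 < n
          positive zero    (s≤s ())
          positive (suc n) _ = s≤s z≤n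

  t : ℕ
  t = 2 ℕ.* m ∸ 1

  t+1≡2m : suc t ≡ 2 ℕ.* m
  t+1≡2m = trans (ℕP.+-comm 1 t) (ℕP.m∸n+n≡m (ℕP.≤-trans 0<m (ℕP.m≤m+n m (m ℕ.+ 0))))

  -- B₀ · (2m)! = (p + 1)(p + 2)⋯(p + t) exactly, since C(4m, 2m) (2m)!² = (p + t)!.
  B₀-exact : B 0 ℕ.* (2 ℕ.* m) ! ≡ Πℕ t (λ i → suc (p ℕ.+ i))
  B₀-exact = ℕP.*-cancelˡ-≡ _ _ (p ℕ.* F) {{ℕ.>-nonZero (ℕP.*-mono-< {0} {p} {0} {F} 0<p (ℕP.1≤n! n))}} (begin
    p ℕ.* F ℕ.* (B 0 ℕ.* F)      ≡⟨ regroup p F (B 0) ⟩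
    p ℕ.* B 0 ℕ.* (F ℕ.* F)      ≡⟨ cong (ℕ._* (F ℕ.* F)) (central-complement 0<m) ⟨
    central n ℕ.* (F ℕ.* F)      ≡⟨ central-factorial n ⟩
    (2 ℕ.* n) !                  ≡⟨ cong _! p+t≡2n ⟨
    (p ℕ.+ t) !                  ≡⟨ rising-factorial p t ⟨
    Π ℕ.* p !                    ≡⟨ cong (Π ℕ.*_) p!≡p*F ⟩
    Π ℕ.* (p ℕ.* F)              ≡⟨ ℕP.*-comm Π (p ℕ.* F) ⟩
    p ℕ.* F ℕ.* Π                ∎)
    where
      open ≡-Reasoning
      n : ℕ
      n = 2 ℕ.* m
      F : ℕ
      F = n !
      Π : ℕ
      Π = Πℕ t (λ i → suc (p ℕ.+ i))
      0<p : 0 < p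
      0<p = ℕP.<-trans (s≤s z≤n) 3<p
      p+t≡2n : p ℕ.+ t ≡ 2 ℕ.* n
      p+t≡2n = trans (cong (ℕ._+ t) p≡2m+1) (trans (sym (ℕP.+-suc n t)) (trans (cong (n ℕ.+_) t+1≡2m) (double n)))
        where double : ∀ x → x ℕ.+ x ≡ 2 ℕ.* x
              double = ℕSolver.solve-∀
      p!≡p*F : p ! ≡ p ℕ.* F
      p!≡p*F = trans (cong _! p≡2m+1) (cong (ℕ._* F) (sym p≡2m+1))
      regroup : ∀ p F b → p ℕ.* F ℕ.* (b ℕ.* F) ≡ p ℕ.* b ℕ.* (F ℕ.* F)
      regroup = ℕSolver.solve-∀

  Π[p+i]≡t! : Π< t (λ i → + suc (p ℕ.+ i)) ≡ + (t !) [mod p ]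
  Π[p+i]≡t! = begin
    Π< t (λ i → + suc (p ℕ.+ i))    ≈⟨ Π-cong-mod t (λ i _ → shift-mod 1 (suc (p ℕ.+ i)) (suc i) (shift i)) ⟩
    Π< t (λ i → + suc i)            ≡⟨ Πℕ-cast t suc ⟨
    + Πℕ t suc                      ≡⟨ cong +_ (trans (sym (ℕP.*-identityʳ (Πℕ t suc))) (rising-factorial 0 t)) ⟩
    + (t !)                         ∎
    where open ≡mod-Reasoning p
          shift : ∀ i → suc (p ℕ.+ i) ≡ 1 ℕ.* p ℕ.+ suc i
          shift i = trans (sym (ℕP.+-suc p i)) (cong (ℕ._+ suc i) (sym (ℕP.*-identityˡ p)))

  [2m]!≡-t! : + ((2 ℕ.* m) !) ≡ - 1ℤ * + (t !) [mod p ]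
  [2m]!≡-t! = begin
    + ((2 ℕ.* m) !)            ≡⟨ cong (λ x → + (x !)) t+1≡2m ⟨
    + (suc t ℕ.* t !)          ≡⟨ cong (λ x → + (x ℕ.* t !)) t+1≡2m ⟩
    + (2 ℕ.* m ℕ.* t !)        ≡⟨ pos-* (2 ℕ.* m) (t !) ⟩
    + (2 ℕ.* m) * + (t !)      ≈⟨ *-congʳ-mod (+ (t !)) (opposite-mod 1 (2 ℕ.* m) 1 2m+1≡p) ⟩
    - 1ℤ * + (t !)             ∎
    where open ≡mod-Reasoning p
          2m+1≡p : 2 ℕ.* m ℕ.+ 1 ≡ 1 ℕ.* p
          2m+1≡p = trans (ℕP.+-comm (2 ℕ.* m) 1) (trans (sym p≡2m+1) (sym (ℕP.*-identityˡ p)))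

  -- Hence t! · (-B₀) ≡ B₀ · (2m)! ≡ t!, and cancelling the unit t! gives B₀ ≡ -1.
  B₀≡-1 : + B 0 ≡ - 1ℤ [mod p ]
  B₀≡-1 = ≡mod-trans (≡⇒≡mod (double-negation (+ B 0))) (-‿cong-mod (cancel-mod₁ (unit-! t t<p) (begin
    + (t !) * - + B 0                    ≡⟨ rearrange (+ (t !)) (+ B 0) ⟩
    + B 0 * (- 1ℤ * + (t !))             ≈⟨ *-congˡ-mod (+ B 0) [2m]!≡-t! ⟨
    + B 0 * + ((2 ℕ.* m) !)              ≡⟨ pos-* (B 0) ((2 ℕ.* m) !) ⟨
    + (B 0 ℕ.* (2 ℕ.* m) !)              ≡⟨ cong +_ B₀-exact ⟩
    + Πℕ t (λ i → suc (p ℕ.+ i))         ≡⟨ Πℕ-cast t (λ i → suc (p ℕ.+ i)) ⟩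
    Π< t (λ i → + suc (p ℕ.+ i))         ≈⟨ Π[p+i]≡t! ⟩
    + (t !)                              ≡⟨ *-identityʳ (+ (t !)) ⟨
    + (t !) * 1ℤ                         ∎)))
    where
      open ≡mod-Reasoning p
      t<p : t < p
      t<p = subst (t <_) (sym (trans p≡2m+1 (cong suc (sym t+1≡2m)))) (ℕP.<-trans (ℕP.n<1+n t) (ℕP.n<1+n (suc t)))
      double-negation : ∀ x → x ≡ - (- x)
      double-negation = solve-∀
      rearrange : ∀ f b → f * - b ≡ b * (- 1ℤ * f)
      rearrange = solve-∀

  A Bℤ d : ℕ → ℤ
  A k  = + central k
  Bℤ k = + B k
  d k  = odd k * A k * Bℤ k

  A-step : ∀ k → A (suc k) * + suc k ≡ + 2 * odd k * A k
  A-step k = trans (sym (pos-* (central (suc k)) (suc k)))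
    (trans (cong +_ (central-step k))
    (trans (pos-* (2 ℕ.* suc (2 ℕ.* k)) (central k)) (cong (_* A k) (pos-* 2 (suc (2 ℕ.* k))))))

  -- The same recurrence at the complementary index j = 2m - k - 1 gives
  -- (j + 1) Bₖ = 2 (2j + 1) Bₖ₊₁, after cancelling p.
  B-step : ∀ {k} → suc k < m → B k ℕ.* suc (complement (suc k)) ≡ 2 ℕ.* suc (2 ℕ.* complement (suc k)) ℕ.* B (suc k)
  B-step {k} sk<m = ℕP.*-cancelˡ-≡ _ _ p (begin
    p ℕ.* (B k ℕ.* suc j)                  ≡⟨ ℕP.*-assoc p (B k) (suc j) ⟨
    p ℕ.* B k ℕ.* suc j                    ≡⟨ cong (ℕ._* suc j) (central-complement k<m) ⟨
    central (complement k) ℕ.* suc j       ≡⟨ cong (λ i → central i ℕ.* suc j) complement-suc ⟩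
    central (suc j) ℕ.* suc j              ≡⟨ central-step j ⟩
    2 ℕ.* suc (2 ℕ.* j) ℕ.* central j      ≡⟨ cong (2 ℕ.* suc (2 ℕ.* j) ℕ.*_) (central-complement sk<m) ⟩
    a ℕ.* (p ℕ.* B (suc k))                ≡⟨ swap a p (B (suc k)) ⟩
    p ℕ.* (a ℕ.* B (suc k))                ∎)
    where
      open ≡-Reasoning
      j : ℕ
      j = complement (suc k)
      a : ℕ
      a = 2 ℕ.* suc (2 ℕ.* j)
      k<m : k < m
      k<m = ℕP.<-trans (ℕP.n<1+n k) sk<m
      complement-suc : complement k ≡ suc j
      complement-suc = ℕP.+-∸-assoc 1 (ℕP.<⇒≤ (i<2m sk<m))
      swap : ∀ a p b → a ℕ.* (p ℕ.* b) ≡ p ℕ.* (a ℕ.* b)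
      swap = ℕSolver.solve-∀

  -- Modulo p, j + 1 ≡ -(k + 1) and 2j + 1 ≡ -(2k + 3), so 2 (2k + 3) Bₖ₊₁ ≡ (k + 1) Bₖ.
  B-step-mod : ∀ {k} → suc k < m → + 2 * odd (suc k) * Bℤ (suc k) ≡ Bℤ k * + suc k [mod p ]
  B-step-mod {k} sk<m = begin
    + 2 * odd (suc k) * Bℤ (suc k)            ≡⟨ negate-twice (odd (suc k)) (Bℤ (suc k)) ⟩
    - (+ 2 * - odd (suc k) * Bℤ (suc k))      ≈⟨ -‿cong-mod (*-congʳ-mod (Bℤ (suc k)) (*-congˡ-mod (+ 2) 2j+1≡-[2k+3])) ⟨
    - (+ 2 * + suc (2 ℕ.* j) * Bℤ (suc k))    ≡⟨ cong -_ exact ⟨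
    - (Bℤ k * + suc j)                        ≈⟨ -‿cong-mod (*-congˡ-mod (Bℤ k) j+1≡-[k+1]) ⟩
    - (Bℤ k * - + suc k)                      ≡⟨ negate-once (Bℤ k) (+ suc k) ⟩
    Bℤ k * + suc k                            ∎
    where
      open ≡mod-Reasoning p
      j : ℕ
      j = complement (suc k)
      j+k+1≡2m : j ℕ.+ suc k ≡ 2 ℕ.* m
      j+k+1≡2m = complement+k (ℕP.<⇒≤ (i<2m sk<m))
      j+1≡-[k+1] : + suc j ≡ - + suc k [mod p ]
      j+1≡-[k+1] = opposite-mod 1 (suc j) (suc k) (trans (cong suc j+k+1≡2m) (trans (sym p≡2m+1) (sym (ℕP.*-identityˡ p))))
      2j+1≡-[2k+3] : + suc (2 ℕ.* j) ≡ - odd (suc k) [mod p ]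
      2j+1≡-[2k+3] = opposite-mod 2 (suc (2 ℕ.* j)) (suc (2 ℕ.* suc k))
        (trans (expand j k) (trans (cong (λ x → 2 ℕ.* suc x) j+k+1≡2m) (cong (2 ℕ.*_) (sym p≡2m+1))))
        where expand : ∀ j k → suc (2 ℕ.* j) ℕ.+ suc (2 ℕ.* suc k) ≡ 2 ℕ.* suc (j ℕ.+ suc k)
              expand = ℕSolver.solve-∀
      exact : Bℤ k * + suc j ≡ + 2 * + suc (2 ℕ.* j) * Bℤ (suc k)
      exact = trans (sym (pos-* (B k) (suc j))) (trans (cong +_ (B-step sk<m))
        (trans (pos-* (2 ℕ.* suc (2 ℕ.* j)) (B (suc k))) (cong (_* Bℤ (suc k)) (pos-* 2 (suc (2 ℕ.* j))))))
      negate-twice : ∀ o b → + 2 * o * b ≡ - (+ 2 * - o * b)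
      negate-twice = solve-∀
      negate-once : ∀ b s → - (b * - s) ≡ b * s
      negate-once = solve-∀

  d-step : ∀ {k} → suc k < m → d (suc k) ≡ d k [mod p ]
  d-step {k} sk<m = cancel-mod₁ (unit-* unit-2 (unit-suc (i<2m (ℕP.<-trans (ℕP.n<1+n k) sk<m)))) (begin
    + 2 * + suc k * d (suc k)                                   ≡⟨ regroup₁ (+ suc k) (odd (suc k)) (A (suc k)) (Bℤ (suc k)) ⟩
    A (suc k) * + suc k * (+ 2 * odd (suc k) * Bℤ (suc k))      ≈⟨ *-congˡ-mod (A (suc k) * + suc k) (B-step-mod sk<m) ⟩
    A (suc k) * + suc k * (Bℤ k * + suc k)                      ≡⟨ cong (_* (Bℤ k * + suc k)) (A-step k) ⟩
    + 2 * odd k * A k * (Bℤ k * + suc k)                        ≡⟨ regroup₂ (+ suc k) (odd k) (A k) (Bℤ k) ⟩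
    + 2 * + suc k * d k                                         ∎)
    where
      open ≡mod-Reasoning p
      regroup₁ : ∀ s o a b → + 2 * s * (o * a * b) ≡ a * s * (+ 2 * o * b)
      regroup₁ = solve-∀
      regroup₂ : ∀ s o a b → + 2 * o * a * (b * s) ≡ + 2 * s * (o * a * b)
      regroup₂ = solve-∀

  d≡-1 : ∀ k → k < m → d k ≡ - 1ℤ [mod p ]
  d≡-1 zero    _    = ≡mod-trans (≡⇒≡mod (*-identityˡ (Bℤ 0))) B₀≡-1
  d≡-1 (suc k) sk<m = ≡mod-trans (d-step sk<m) (d≡-1 k (ℕP.<-trans (ℕP.n<1+n k) sk<m))

module MainCongruence (p : ℕ) (isPrime : Prime p) (m : ℕ) (p≡2m+1 : p ≡ suc (2 ℕ.* m)) (3<p : 3 < p) where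
  open import Data.Nat as ℕ using (ℕ; zero; suc; _∸_; _<_; _^_)
  import Data.Nat.Properties as ℕP
  open import Data.Integer using (ℤ; +_; _+_; _*_; 0ℤ)
  open import Data.Integer.Properties using (pos-*; pos-+; +-identityˡ)
  open import Data.Integer.Divisibility.Signed using (_∣_; *-monoʳ-∣)
  open import Data.Integer.Tactic.RingSolver using (solve-∀)
  import Data.Nat.Tactic.RingSolver as ℕSolver
  open import Relation.Binary.PropositionalEquality
  open Congruence
  open FiniteSums
  open CentralBinomial

  open InverseOddSquares p isPrime m p≡2m+1 3<p
  open Morley p isPrime m p≡2m+1 3<p using (morley²; p^3≡p*p*p)
  open CentralQuotients p isPrime m p≡2m+1 3<p

  sumTo-cast : ∀ n f → + sumTo n f ≡ Σ< (suc n) (λ k → + f k)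
  sumTo-cast zero    f = sym (+-identityˡ (+ f 0))
  sumTo-cast (suc n) f = trans (pos-+ (sumTo n f) (f (suc n))) (cong (_+ + f (suc n)) (sumTo-cast n f))

  term : ℕ → ℤ
  term k = + (central k ℕ.^ 2 ℕ.* central (complement k) ℕ.^ 2)

  square : ∀ x → + (x ℕ.^ 2) ≡ + x * + x
  square x = trans (cong +_ (cong (x ℕ.*_) (ℕP.*-identityʳ x))) (pos-* x x)

  term-mirror : ∀ i → i < m → term (suc m ℕ.+ i) ≡ term (m ∸ suc i)
  term-mirror i i<m = begin
    + (central (suc m ℕ.+ i) ℕ.^ 2 ℕ.* central (complement (suc m ℕ.+ i)) ℕ.^ 2)
                            ≡⟨ cong (λ x → + (central (suc m ℕ.+ i) ℕ.^ 2 ℕ.* central x ℕ.^ 2)) complement₁ ⟩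
    + (central (suc m ℕ.+ i) ℕ.^ 2 ℕ.* central j ℕ.^ 2)
                            ≡⟨ cong +_ (ℕP.*-comm (central (suc m ℕ.+ i) ℕ.^ 2) (central j ℕ.^ 2)) ⟩
    + (central j ℕ.^ 2 ℕ.* central (suc m ℕ.+ i) ℕ.^ 2)
                            ≡⟨ cong (λ x → + (central j ℕ.^ 2 ℕ.* central x ℕ.^ 2)) complement₂ ⟨
    + (central j ℕ.^ 2 ℕ.* central (complement j) ℕ.^ 2)
                            ∎
    where
      open ≡-Reasoning
      j : ℕ
      j = m ∸ suc i
      total : 2 ℕ.* m ≡ suc m ℕ.+ i ℕ.+ j
      total = trans 2m≡m+m (sym (trans (regroup m i j) (cong (m ℕ.+_) (ℕP.m∸n+n≡m i<m))))
        where regroup : ∀ m i j → suc m ℕ.+ i ℕ.+ j ≡ m ℕ.+ (j ℕ.+ suc i)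
              regroup = ℕSolver.solve-∀
      complement₁ : complement (suc m ℕ.+ i) ≡ j
      complement₁ = trans (cong (_∸ (suc m ℕ.+ i)) total) (ℕP.m+n∸m≡n (suc m ℕ.+ i) j)
      complement₂ : complement j ≡ suc m ℕ.+ i
      complement₂ = trans (cong (_∸ j) total) (ℕP.m+n∸n≡m (suc m ℕ.+ i) j)

  term-below : ∀ k → k < m → term k ≡ + p * + p * (A k * Bℤ k * (A k * Bℤ k))
  term-below k k<m = begin
    + (central k ℕ.^ 2 ℕ.* central (complement k) ℕ.^ 2)   ≡⟨ pos-* (central k ℕ.^ 2) (central (complement k) ℕ.^ 2) ⟩
    + (central k ℕ.^ 2) * + (central (complement k) ℕ.^ 2)  ≡⟨ cong₂ _*_ (square (central k)) (square (central (complement k))) ⟩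
    A k * A k * (+ central (complement k) * + central (complement k))
                                                            ≡⟨ cong (λ x → A k * A k * (x * x)) (trans (cong +_ (central-complement k<m)) (pos-* p (B k))) ⟩
    A k * A k * (+ p * Bℤ k * (+ p * Bℤ k))                 ≡⟨ regroup (A k) (Bℤ k) (+ p) ⟩
    + p * + p * (A k * Bℤ k * (A k * Bℤ k))                 ∎
    where open ≡-Reasoning
          regroup : ∀ a b q → a * a * (q * b * (q * b)) ≡ q * q * (a * b * (a * b))
          regroup = solve-∀

  -- Σ_{k<m} (Aₖ Bₖ)² ≡ 0 (mod p), because (Aₖ Bₖ)² is an inverse of (2k + 1)²,
  -- so the terms below the middle vanish modulo p³.
  Σ-below≡0 : Σ< m term ≡ 0ℤ [mod p ^ 3 ]
  Σ-below≡0 = ∣⇒≡0-mod (subst (_∣ Σ< m term) (sym p^3≡p*p*p)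
    (subst (+ p * + p * + p ∣_) (sym Σ-factor) (*-monoʳ-∣ (+ p * + p) (≡0-mod⇒∣ Σ[AB]²≡0))))
    where
      AB² : ℕ → ℤ
      AB² k = A k * Bℤ k * (A k * Bℤ k)
      Σ[AB]²≡0 : Σ< m AB² ≡ 0ℤ [mod p ]
      Σ[AB]²≡0 = Σ-inverse-odd-squares AB² (λ k k<m → ≡mod-trans (≡⇒≡mod (regroup (odd k) (A k) (Bℤ k)))
                                                                 (*-cong-mod (d≡-1 k k<m) (d≡-1 k k<m)))
        where regroup : ∀ o a b → o * o * (a * b * (a * b)) ≡ o * a * b * (o * a * b)
              regroup = solve-∀
      Σ-factor : Σ< m term ≡ + p * + p * Σ< m AB²
      Σ-factor = trans (Σ-cong m term-below) (Σ-*ˡ m (+ p * + p) AB²)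

  term-middle : term m ≡ + (256 ^ (2 ℕ.* m)) [mod p ^ 3 ]
  term-middle = begin
    term m                               ≡⟨ cong (λ x → + (central m ℕ.^ 2 ℕ.* central x ℕ.^ 2)) complement-m ⟩
    + (central m ℕ.^ 2 ℕ.* central m ℕ.^ 2)  ≡⟨ pos-* (central m ℕ.^ 2) (central m ℕ.^ 2) ⟩
    + (central m ℕ.^ 2) * + (central m ℕ.^ 2)  ≡⟨ cong₂ _*_ (square (central m)) (square (central m)) ⟩
    A m * A m * (A m * A m)              ≈⟨ *-cong-mod morley² morley² ⟩
    + (256 ^ m) * + (256 ^ m)            ≡⟨ pos-* (256 ^ m) (256 ^ m) ⟨
    + (256 ^ m ℕ.* 256 ^ m)              ≡⟨ cong +_ (trans (sym (ℕP.^-distribˡ-+-* 256 m m)) (cong (256 ^_) (sym 2m≡m+m))) ⟩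
    + (256 ^ (2 ℕ.* m))                  ∎
    where open ≡mod-Reasoning (p ^ 3)
          complement-m : complement m ≡ m
          complement-m = trans (cong (_∸ m) 2m≡m+m) (ℕP.m+n∸m≡n m m)

  V≡256^2m : + V (2 ℕ.* m) ≡ + (256 ^ (2 ℕ.* m)) [mod p ^ 3 ]
  V≡256^2m = begin
    + V (2 ℕ.* m)                                ≡⟨ sumTo-cast (2 ℕ.* m) (λ k → central k ℕ.^ 2 ℕ.* central (complement k) ℕ.^ 2) ⟩
    Σ< (suc (2 ℕ.* m)) term                      ≡⟨ cong (λ n → Σ< (suc n) term) 2m≡m+m ⟩
    Σ< (suc m ℕ.+ m) term                        ≈⟨ Σ-mirror (suc m) m term (λ i i<m → ≡⇒≡mod (term-mirror i i<m)) ⟩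
    Σ< m term + term m + Σ< m term               ≈⟨ +-cong-mod (+-cong-mod Σ-below≡0 term-middle) Σ-below≡0 ⟩
    0ℤ + + (256 ^ (2 ℕ.* m)) + 0ℤ                ≡⟨ drop-zeros (+ (256 ^ (2 ℕ.* m))) ⟩
    + (256 ^ (2 ℕ.* m))                          ∎
    where
      open ≡mod-Reasoning (p ^ 3)
      drop-zeros : ∀ x → 0ℤ + x + 0ℤ ≡ x
      drop-zeros = solve-∀

open import Data.Nat using (zero; _∸_; _^_; _>_; z≤n; s≤s)
import Data.Nat.Properties as ℕP
import Data.Nat.Divisibility as ℕD
open import Data.Nat.Primality using (prime⇒irreducible)
open import Data.Integer using (+_; _-_)
open import Data.Integer.Divisibility using (_∣_)
open import Data.Integer.Divisibility.Signed using (∣⇒∣ᵤ)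
open import Data.Sum using (_⊎_; inj₁; inj₂)
open import Data.Product using (∃-syntax; _,_)
open import Data.Empty using (⊥-elim)
open import Relation.Binary.PropositionalEquality using (_≡_; refl; sym; trans; cong)

parity : ∀ n → ∃[ m ] n ≡ 2 ℕ.* m ⊎ ∃[ m ] n ≡ suc (2 ℕ.* m)
parity zero = inj₁ (0 , refl)
parity (suc n) with parity n
... | inj₁ (m , n≡2m)   = inj₂ (m , cong suc n≡2m)
... | inj₂ (m , n≡2m+1) = inj₁ (suc m , trans (cong suc n≡2m+1) (sym (ℕP.*-suc 2 m)))

odd-prime : ∀ p → Prime p → 3 < p → ∃[ m ] p ≡ suc (2 ℕ.* m)
odd-prime p isPrime 3<p with parity p
... | inj₂ odd = odd
... | inj₁ (m , p≡2m) with prime⇒irreducible isPrime (ℕD.divides m (trans p≡2m (ℕP.*-comm 2 m)))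
...   | inj₁ ()
...   | inj₂ 2≡p = ⊥-elim (ℕP.<⇒≢ (ℕP.<-trans (s≤s (s≤s (s≤s z≤n))) 3<p) 2≡p)

theorem3p3 : (p : ℕ) → Prime p → p > 3 →
    (+ (p ^ 3)) ∣ ((+ V (p ∸ 1)) - (+ (256 ^ (p ∸ 1))))
theorem3p3 p isPrime 3<p with odd-prime p isPrime 3<p
... | m , p≡2m+1 rewrite cong (_∸ 1) p≡2m+1 =
  ∣⇒∣ᵤ (Congruence.divides-difference (MainCongruence.V≡256^2m p isPrime m p≡2m+1 3<p))
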